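{- Let $r$ be a positive integer and $p=2r+3$. Then the smallest positive integer $n$ such that $n\cdot\frac{3(p-2s)^2-p}{24p}\in\mathbb{Z}$ for every integer $s$ with $0\le s\le (p-1)/2$ (equivalently, the least common multiple of the denominators of these fractions written in lowest terms) equals $$\frac{12(2r+3)}{\gcd(4,r)\,\gcd(3,r)}.$$ -}

module Defs where

open import Data.Nat as ℕ using (ℕ; suc; _≤_; _<_; _∸_; NonZero)
open import Data.Nat.GCD using (gcd)
import Data.Nat.GCD
import Data.Sum
open import Data.Nat.Properties using (*-comm)
open import Data.Integer as ℤ using (ℤ; +_)
open import Data.Integer.Divisibility using () renaming (_∣_ to _∣ℤ_)
open import Data.Product using (_×_)

pOf : ℕ → ℕ
pOf r = 2 ℕ.* r ℕ.+ 3

numer : ℕ → ℕ → ℤ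
numer p s = (+ 3) ℤ.* ((+ p ℤ.- + (2 ℕ.* s)) ℤ.* (+ p ℤ.- + (2 ℕ.* s))) ℤ.- + p

-- n · (3(p-2s)^2 - p)/(24p) is an integer  ⟺  24p ∣ n·(3(p-2s)^2 - p) in ℤ
-- (this is an exact unfolding since 24p > 0)
Clears : ℕ → ℕ → Set
Clears p n = ∀ (s : ℕ) → s ≤ (p ∸ 1) ℕ./ 2 → (+ (24 ℕ.* p)) ∣ℤ ((+ n) ℤ.* numer p s)

IsLeastPositive : (ℕ → Set) → ℕ → Set
IsLeastPositive P n = (0 < n) × P n × (∀ m → 0 < m → P m → n ≤ m)

gcdDen : ℕ → ℕ
gcdDen r = gcd 4 r ℕ.* gcd 3 r

gcdDenNonZero : ∀ r → NonZero (gcdDen r)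
gcdDenNonZero r = lemma (gcd 4 r) (gcd 3 r) (Data.Nat.GCD.gcd[m,n]≢0 4 r (Data.Sum.inj₁ (λ ()))) (Data.Nat.GCD.gcd[m,n]≢0 3 r (Data.Sum.inj₁ (λ ())))
  where
  open import Relation.Binary.PropositionalEquality using (_≢_; refl)
  import Data.Sum
  lemma : ∀ a b → a ≢ 0 → b ≢ 0 → NonZero (a ℕ.* b)
  lemma 0 _ a≢0 _ with () ← a≢0 refl
  lemma (suc a) 0 _ b≢0 with () ← b≢0 refl
  lemma (suc a) (suc b) _ _ = _

-- the claimed value 12(2r+3) / (gcd(4,r)·gcd(3,r))  (exact division in ℕ)
claimed : ℕ → ℕ
claimed r = ℕ._/_ (12 ℕ.* (2 ℕ.* r ℕ.+ 3)) (gcdDen r) {{gcdDenNonZero r}}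

{-# OPTIONS --safe #-}
module Submission where

-- With u = r + 1 - s we have p - 2s = 2u + 1, hence 3(p - 2s)² - p = 12u(u + 1) - 2r, and u(u + 1)
-- is even: every numerator is congruent to -2r modulo 24. So a multiple tp of p clears all the
-- fractions iff 12 ∣ tr, i.e. iff 12 / gcd(12, r) divides t. Every n that clears them is a multiple
-- of p, because the numerators for s = 0 and s = 1 differ by 12p - 12. Finally, 4 and 3 being
-- coprime, gcd(12, r) = gcd(4, r) gcd(3, r).

open import Defs
open import Data.Nat
  using (ℕ; _≤_; zero; suc; _+_; _*_; _∸_; _/_; _<_; z≤n; s≤s; NonZero; ≢-nonZero; >-nonZero; >-nonZero⁻¹)
open import Data.Nat.Properties using (*-comm; *-assoc; m+[n∸m]≡n; m*n≢0; m*n≢0⇒m≢0; *-monoˡ-≤)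
open import Data.Nat.Divisibility
  using (_∣_; divides; ∣-trans; ∣-antisym; ∣⇒≤; ∣m∣n⇒∣m+n; ∣n⇒∣m*n; m∣m*n; n∣m*n
        ; *-pres-∣; *-monoʳ-∣; *-cancelˡ-∣; *-cancelʳ-∣)
open import Data.Nat.DivMod using (m*n/n≡m; m/n*n≡m; /-congʳ; *-/-assoc)
open import Data.Nat.GCD
  using (gcd; gcd[m,n]∣m; gcd[m,n]∣n; gcd-greatest; gcd[m,n]≢0; c*gcd[m,n]≡gcd[cm,cn]; m/gcd[m,n]≢0)
open import Data.Nat.Coprimality
  using (Coprime; coprime-divisor; coprime-/gcd; gcd≡1⇒coprime) renaming (sym to coprime-sym)
import Data.Nat.Tactic.RingSolver as ℕ-Solver
open import Data.Integer as ℤ using (+_)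
open import Data.Integer.Properties using (pos-+; pos-*)
open import Data.Integer.Divisibility using () renaming (_∣_ to _∣ᵤ_)
import Data.Integer.Divisibility.Signed as ℤ∣
open import Data.Integer.Tactic.RingSolver using (solve-∀)
open import Data.Sum using (inj₁)
open import Data.Product using (_,_)
open import Data.List.Base using (_∷_; [])
open import Function.Base using (_∘_)
open import Function.Bundles using (_⇔_; mk⇔; module Equivalence)
open import Function.Construct.Composition using (_⇔-∘_)
open import Relation.Binary.PropositionalEquality

coprime-∣ : ∀ {m n d e} → Coprime m n → d ∣ m → e ∣ n → Coprime d e
coprime-∣ c d∣m e∣n (i∣d , i∣e) = c (∣-trans i∣d d∣m , ∣-trans i∣e e∣n)

coprime⇒*∣ : ∀ {m n o} → Coprime m n → m ∣ o → n ∣ o → m * n ∣ o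
coprime⇒*∣ {m} {n} c (divides q refl) n∣q*m = subst (m * n ∣_) (*-comm m q)
  (*-monoʳ-∣ m (coprime-divisor (coprime-sym c) (subst (n ∣_) (*-comm q m) n∣q*m)))

gcd[m*n,o]∣gcd[m,o]*gcd[n,o] : ∀ m n o → gcd (m * n) o ∣ gcd m o * gcd n o
gcd[m*n,o]∣gcd[m,o]*gcd[n,o] m n o =
  subst (d ∣_) (sym (c*gcd[m,n]≡gcd[cm,cn] (gcd m o) n o))
    (gcd-greatest d∣gcd[m,o]*n (∣n⇒∣m*n (gcd m o) d∣o))
  where
  d = gcd (m * n) o
  d∣o : d ∣ o
  d∣o = gcd[m,n]∣n (m * n) o
  d∣gcd[m,o]*n : d ∣ gcd m o * n
  d∣gcd[m,o]*n = subst (d ∣_) (trans (sym (c*gcd[m,n]≡gcd[cm,cn] n m o)) (*-comm n (gcd m o)))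
    (gcd-greatest (subst (d ∣_) (*-comm m n) (gcd[m,n]∣m (m * n) o)) (∣n⇒∣m*n n d∣o))

coprime⇒gcd[m*n,o]≡gcd[m,o]*gcd[n,o] : ∀ {m n} o → Coprime m n →
                                       gcd (m * n) o ≡ gcd m o * gcd n o
coprime⇒gcd[m*n,o]≡gcd[m,o]*gcd[n,o] {m} {n} o c = ∣-antisym
  (gcd[m*n,o]∣gcd[m,o]*gcd[n,o] m n o)
  (gcd-greatest (*-pres-∣ (gcd[m,n]∣m m o) (gcd[m,n]∣m n o))
                (coprime⇒*∣ (coprime-∣ c (gcd[m,n]∣m m o) (gcd[m,n]∣m n o))
                            (gcd[m,n]∣n m o) (gcd[m,n]∣n n o)))

m∣[m/gcd[m,n]]*n : ∀ m n .{{_ : NonZero (gcd m n)}} → m ∣ (m / gcd m n) * n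
m∣[m/gcd[m,n]]*n m n = subst (m ∣_) (sym [m/g]*n≡m*[n/g]) (m∣m*n (n / g))
  where
  open ≡-Reasoning
  g = gcd m n
  [m/g]*n≡m*[n/g] : (m / g) * n ≡ m * (n / g)
  [m/g]*n≡m*[n/g] = begin
    (m / g) * n             ≡⟨ cong ((m / g) *_) (sym (m/n*n≡m (gcd[m,n]∣n m n))) ⟩
    (m / g) * (n / g * g)   ≡⟨ reorder (m / g) (n / g) g ⟩
    (m / g * g) * (n / g)   ≡⟨ cong (_* (n / g)) (m/n*n≡m (gcd[m,n]∣m m n)) ⟩
    m * (n / g)             ∎
    where
    reorder : ∀ x y z → x * (y * z) ≡ (x * z) * y
    reorder = ℕ-Solver.solve-∀

m∣o*n⇒m/gcd[m,n]∣o : ∀ {m n o} .{{_ : NonZero (gcd m n)}} → m ∣ o * n → m / gcd m n ∣ o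
m∣o*n⇒m/gcd[m,n]∣o {m} {n} {o} m∣o*n =
  coprime-divisor (coprime-/gcd m n)
    (subst (m / g ∣_) (*-comm o (n / g)) (*-cancelʳ-∣ g m′g∣o*n′*g))
  where
  g = gcd m n
  m′g∣o*n′*g : m / g * g ∣ o * (n / g) * g
  m′g∣o*n′*g = subst₂ _∣_ (sym (m/n*n≡m (gcd[m,n]∣m m n)))
    (trans (cong (o *_) (sym (m/n*n≡m (gcd[m,n]∣n m n)))) (sym (*-assoc o (n / g) g))) m∣o*n

isLeastPositive-multiple : ∀ {P : ℕ → Set} {k n p}
                           .{{_ : NonZero k}} .{{_ : NonZero (gcd k n)}} .{{_ : NonZero p}} →
                           (∀ {m} → P m → p ∣ m) → (∀ t → P (t * p) ⇔ k ∣ t * n) →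
                           IsLeastPositive P (k / gcd k n * p)
isLeastPositive-multiple {P} {k} {n} {p} P⇒p∣ P[t*p]⇔k∣t*n =
  >-nonZero⁻¹ (k / g * p) {{m*n≢0 (k / g) p {{≢-nonZero (m/gcd[m,n]≢0 k n)}}}}
  , Equivalence.from (P[t*p]⇔k∣t*n (k / g)) (m∣[m/gcd[m,n]]*n k n)
  , least
  where
  g = gcd k n
  least : ∀ m → 0 < m → P m → k / g * p ≤ m
  least m m>0 Pm with P⇒p∣ Pm
  ... | divides t m≡t*p = subst (k / g * p ≤_) (sym m≡t*p) (*-monoˡ-≤ p (∣⇒≤ {{t≢0}} k/g∣t))
    where
    t≢0 : NonZero t
    t≢0 = m*n≢0⇒m≢0 t {{>-nonZero (subst (0 <_) m≡t*p m>0)}}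
    k/g∣t : k / g ∣ t
    k/g∣t = m∣o*n⇒m/gcd[m,n]∣o (Equivalence.to (P[t*p]⇔k∣t*n t) (subst P m≡t*p Pm))

2∣n*[1+n] : ∀ n → 2 ∣ n * suc n
2∣n*[1+n] zero    = divides 0 refl
2∣n*[1+n] (suc n) = subst (2 ∣_) (step n) (∣m∣n⇒∣m+n (2∣n*[1+n] n) (m∣m*n (suc n)))
  where
  step : ∀ n → n * suc n + 2 * suc n ≡ suc n * suc (suc n)
  step = ℕ-Solver.solve-∀

+[m+n]-+m≡+n : ∀ m n → + (m + n) ℤ.- + m ≡ + n
+[m+n]-+m≡+n m n = trans (cong (ℤ._- + m) (pos-+ m n)) (ring (+ m) (+ n))
  where
  ring : ∀ M N → M ℤ.+ N ℤ.- M ≡ N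
  ring = solve-∀

+[m+o]-+[n+o]≡+m-+n : ∀ m n o → + (m + o) ℤ.- + (n + o) ≡ + m ℤ.- + n
+[m+o]-+[n+o]≡+m-+n m n o = trans (cong₂ ℤ._-_ (pos-+ m o) (pos-+ n o)) (ring (+ m) (+ n) (+ o))
  where
  ring : ∀ M N O → M ℤ.+ O ℤ.- (N ℤ.+ O) ≡ M ℤ.- N
  ring = solve-∀

+m*[+n-+o]≡+[m*n]-+[m*o] : ∀ m n o → + m ℤ.* (+ n ℤ.- + o) ≡ + (m * n) ℤ.- + (m * o)
+m*[+n-+o]≡+[m*n]-+[m*o] m n o =
  trans (ring (+ m) (+ n) (+ o)) (sym (cong₂ ℤ._-_ (pos-* m n) (pos-* m o)))
  where
  ring : ∀ M N O → M ℤ.* (N ℤ.- O) ≡ M ℤ.* N ℤ.- M ℤ.* O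
  ring = solve-∀

∣m⇒[∣ᵤ+m-+n⇔∣n] : ∀ {d m n} → d ∣ m → (+ d ∣ᵤ + m ℤ.- + n) ⇔ d ∣ n
∣m⇒[∣ᵤ+m-+n⇔∣n] {d} {m} {n} d∣m = mk⇔
  (λ d∣m-n → ℤ∣.∣⇒∣ᵤ (subst (+ d ℤ∣.∣_) (ring (+ m) (+ n))
                       (ℤ∣.∣m∣n⇒∣m-n d∣+m (ℤ∣.∣ᵤ⇒∣ {+ d} {+ m ℤ.- + n} d∣m-n))))
  (λ d∣n → ℤ∣.∣⇒∣ᵤ (ℤ∣.∣m∣n⇒∣m-n d∣+m (ℤ∣.∣ᵤ⇒∣ {+ d} {+ n} d∣n)))
  where
  d∣+m : + d ℤ∣.∣ + m
  d∣+m = ℤ∣.∣ᵤ⇒∣ {+ d} {+ m} d∣m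
  ring : ∀ M N → M ℤ.- (M ℤ.- N) ≡ N
  ring = solve-∀

2r+3≡1+[1+r]*2 : ∀ r → 2 * r + 3 ≡ suc (suc r * 2)
2r+3≡1+[1+r]*2 = ℕ-Solver.solve-∀

pOf≢0 : ∀ r → NonZero (pOf r)
pOf≢0 r = subst NonZero (sym (2r+3≡1+[1+r]*2 r)) _

[pOf∸1]/2≡1+r : ∀ r → (pOf r ∸ 1) / 2 ≡ suc r
[pOf∸1]/2≡1+r r = trans (cong (λ x → (x ∸ 1) / 2) (2r+3≡1+[1+r]*2 r)) (m*n/n≡m (suc r) 2)

numer-pOf : ∀ {r s u} → s + u ≡ suc r → numer (pOf r) s ≡ + (12 * (u * suc u)) ℤ.- + (2 * r)
numer-pOf {r} {s} {u} s+u≡1+r = begin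
  numer (pOf r) s
    ≡⟨ cong (λ x → + 3 ℤ.* (x ℤ.* x) ℤ.- + pOf r) p-2s≡2u+1 ⟩
  + 3 ℤ.* (+ (2 * u + 1) ℤ.* + (2 * u + 1)) ℤ.- + pOf r
    ≡⟨ cong (ℤ._- + pOf r) (sym (trans (pos-* 3 ((2 * u + 1) * (2 * u + 1)))
                                       (cong (+ 3 ℤ.*_) (pos-* (2 * u + 1) (2 * u + 1))))) ⟩
  + (3 * ((2 * u + 1) * (2 * u + 1))) ℤ.- + (2 * r + 3)
    ≡⟨ cong (λ x → + x ℤ.- + (2 * r + 3)) (three-odd² u) ⟩
  + (12 * (u * suc u) + 3) ℤ.- + (2 * r + 3)
    ≡⟨ +[m+o]-+[n+o]≡+m-+n (12 * (u * suc u)) (2 * r) 3 ⟩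
  + (12 * (u * suc u)) ℤ.- + (2 * r) ∎
  where
  open ≡-Reasoning
  three-odd² : ∀ u → 3 * ((2 * u + 1) * (2 * u + 1)) ≡ 12 * (u * suc u) + 3
  three-odd² = ℕ-Solver.solve-∀
  2s+[2u+1]≡p : 2 * s + (2 * u + 1) ≡ pOf r
  2s+[2u+1]≡p = begin
    2 * s + (2 * u + 1)   ≡⟨ ℕ-Solver.solve (s ∷ u ∷ []) ⟩
    2 * (s + u) + 1       ≡⟨ cong (λ x → 2 * x + 1) s+u≡1+r ⟩
    2 * suc r + 1         ≡⟨ ℕ-Solver.solve (r ∷ []) ⟩
    2 * r + 3             ∎
  p-2s≡2u+1 : + pOf r ℤ.- + (2 * s) ≡ + (2 * u + 1)
  p-2s≡2u+1 = trans (cong (λ x → + x ℤ.- + (2 * s)) (sym 2s+[2u+1]≡p))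
                    (+[m+n]-+m≡+n (2 * s) (2 * u + 1))

clears⇒∣ : ∀ {p n} → 1 ≤ (p ∸ 1) / 2 → Clears p n → p ∣ n
clears⇒∣ {p} {n} 1≤bound cl =
  *-cancelˡ-∣ 24 (ℤ∣.∣⇒∣ᵤ (subst (+ (24 * p) ℤ∣.∣_) (sym 24n≡combination) combination))
  where
  c₀ : + (24 * p) ℤ∣.∣ + n ℤ.* numer p 0
  c₀ = ℤ∣.∣ᵤ⇒∣ (cl 0 z≤n)
  c₁ : + (24 * p) ℤ∣.∣ + n ℤ.* numer p 1
  c₁ = ℤ∣.∣ᵤ⇒∣ (cl 1 1≤bound)
  combination : + (24 * p) ℤ∣.∣ + n ℤ.* (+ 24 ℤ.* + p) ℤ.+ + 2 ℤ.* (+ n ℤ.* numer p 1)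
                                                    ℤ.- + 2 ℤ.* (+ n ℤ.* numer p 0)
  combination = ℤ∣.∣m∣n⇒∣m-n
    (ℤ∣.∣m∣n⇒∣m+n (ℤ∣.∣n⇒∣m*n (+ n) (ℤ∣.∣-reflexive (pos-* 24 p))) (ℤ∣.∣n⇒∣m*n (+ 2) c₁))
    (ℤ∣.∣n⇒∣m*n (+ 2) c₀)
  ring : ∀ N P → + 24 ℤ.* N ≡ N ℤ.* (+ 24 ℤ.* P)
                              ℤ.+ + 2 ℤ.* (N ℤ.* (+ 3 ℤ.* ((P ℤ.- + 2) ℤ.* (P ℤ.- + 2)) ℤ.- P))
                              ℤ.- + 2 ℤ.* (N ℤ.* (+ 3 ℤ.* ((P ℤ.- + 0) ℤ.* (P ℤ.- + 0)) ℤ.- P))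
  ring = solve-∀
  24n≡combination : + (24 * n) ≡ + n ℤ.* (+ 24 ℤ.* + p) ℤ.+ + 2 ℤ.* (+ n ℤ.* numer p 1)
                                                      ℤ.- + 2 ℤ.* (+ n ℤ.* numer p 0)
  24n≡combination = trans (pos-* 24 n) (ring (+ n) (+ p))

24p∣t*p*numer⇔12∣t*r : ∀ {r s u} t → s + u ≡ suc r →
                       (+ (24 * pOf r) ∣ᵤ + (t * pOf r) ℤ.* numer (pOf r) s) ⇔ 12 ∣ t * r
24p∣t*p*numer⇔12∣t*r {r} {s} {u} t s+u≡1+r =
  cancel-2p ⇔-∘ (∣m⇒[∣ᵤ+m-+n⇔∣n] 24p∣t*p*a ⇔-∘ expand⇔)
  where
  p = pOf r
  a = 12 * (u * suc u)
  expand : + (t * p) ℤ.* numer p s ≡ + (t * p * a) ℤ.- + (t * p * (2 * r))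
  expand = trans (cong (+ (t * p) ℤ.*_) (numer-pOf {r} {s} {u} s+u≡1+r))
                 (+m*[+n-+o]≡+[m*n]-+[m*o] (t * p) a (2 * r))
  expand⇔ : (+ (24 * p) ∣ᵤ + (t * p) ℤ.* numer p s) ⇔ (+ (24 * p) ∣ᵤ + (t * p * a) ℤ.- + (t * p * (2 * r)))
  expand⇔ = mk⇔ (subst (+ (24 * p) ∣ᵤ_) expand) (subst (+ (24 * p) ∣ᵤ_) (sym expand))
  24p∣t*p*a : 24 * p ∣ t * p * a
  24p∣t*p*a = subst (_∣ t * p * a) (*-comm p 24) (*-pres-∣ (n∣m*n t) (*-monoʳ-∣ 12 (2∣n*[1+n] u)))
  24p≡2p*12 : ∀ p → 24 * p ≡ 2 * p * 12
  24p≡2p*12 = ℕ-Solver.solve-∀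
  t*p*2r≡2p*[t*r] : ∀ t p r → t * p * (2 * r) ≡ 2 * p * (t * r)
  t*p*2r≡2p*[t*r] = ℕ-Solver.solve-∀
  cancel-2p : (24 * p ∣ t * p * (2 * r)) ⇔ 12 ∣ t * r
  cancel-2p = mk⇔
    (*-cancelˡ-∣ {12} {t * r} (2 * p) {{m*n≢0 2 p {{_}} {{pOf≢0 r}}}}
      ∘ subst₂ _∣_ (24p≡2p*12 p) (t*p*2r≡2p*[t*r] t p r))
    (subst₂ _∣_ (sym (24p≡2p*12 p)) (sym (t*p*2r≡2p*[t*r] t p r)) ∘ *-monoʳ-∣ (2 * p))

clears[t*pOf]⇔12∣t*r : ∀ r t → Clears (pOf r) (t * pOf r) ⇔ 12 ∣ t * r
clears[t*pOf]⇔12∣t*r r t = mk⇔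
  (λ cl → Equivalence.to (24p∣t*p*numer⇔12∣t*r {r} {0} {suc r} t refl) (cl 0 z≤n))
  (λ 12∣t*r s s≤bound → Equivalence.from
     (24p∣t*p*numer⇔12∣t*r {r} {s} t (m+[n∸m]≡n (subst (s ≤_) ([pOf∸1]/2≡1+r r) s≤bound))) 12∣t*r)

gcd[12,n]≢0 : ∀ n → NonZero (gcd 12 n)
gcd[12,n]≢0 n = ≢-nonZero (gcd[m,n]≢0 12 n (inj₁ λ ()))

claimed≡12/gcd[12,r]*pOf : ∀ r .{{_ : NonZero (gcd 12 r)}} → claimed r ≡ 12 / gcd 12 r * pOf r
claimed≡12/gcd[12,r]*pOf r = begin
  claimed r          ≡⟨ /-congʳ {{gcdDenNonZero r}} gcdDen≡gcd[12,r] ⟩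
  12 * p / gcd 12 r  ≡⟨ cong (_/ gcd 12 r) (*-comm 12 p) ⟩
  p * 12 / gcd 12 r  ≡⟨ *-/-assoc p (gcd[m,n]∣m 12 r) ⟩
  p * (12 / gcd 12 r)≡⟨ *-comm p _ ⟩
  12 / gcd 12 r * p  ∎
  where
  open ≡-Reasoning
  p = pOf r
  gcdDen≡gcd[12,r] : gcdDen r ≡ gcd 12 r
  gcdDen≡gcd[12,r] = sym (coprime⇒gcd[m*n,o]≡gcd[m,o]*gcd[n,o] {4} {3} r (gcd≡1⇒coprime refl))

mainTheorem4 : ∀ (r : ℕ) → 1 ≤ r → IsLeastPositive (Clears (pOf r)) (claimed r)
mainTheorem4 r _ = subst (IsLeastPositive (Clears (pOf r))) (sym (claimed≡12/gcd[12,r]*pOf r))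
  (isLeastPositive-multiple {{_}} {{_}} {{pOf≢0 r}} (clears⇒∣ 1≤[pOf∸1]/2) (clears[t*pOf]⇔12∣t*r r))
  where
  instance
    _ = gcd[12,n]≢0 r
  1≤[pOf∸1]/2 : 1 ≤ (pOf r ∸ 1) / 2
  1≤[pOf∸1]/2 = subst (1 ≤_) (sym ([pOf∸1]/2≡1+r r)) (s≤s z≤n)
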